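{- For integers $n\ge 0$ and $0\le k\le \lfloor n/2\rfloor$, the number $c_{n,k}$ of tilings of the honeycomb strip $H_n$ using exactly $k$ dimers and $n-2k$ monomers equals $$c_{n,k}=\sum_{m=0}^{k}\binom{n-k-m}{m}\binom{n-k-m}{n-2k}.$$
   Context: The honeycomb strip $H_n$ consists of $n$ regular hexagons arranged in two rows, numbered $1,\dots,n$ from the bottom left so that odd-numbered hexagons form the bottom row and even-numbered ones the top row; hexagon $i$ shares an edge with hexagons $i\pm1$ and $i\pm2$ (when they exist), and with no others. A monomer is a single hexagon; a dimer is a pair of edge-adjacent hexagons, i.e. either $\{i,i+1\}$ (slanted) or $\{i,i+2\}$ (horizontal). A tiling of $H_n$ is a partition of its $n$ hexagons into monomers and dimers. Binomial coefficients $\binom{a}{b}$ with $b>a\ge0$ or $b<0$ are $0$. -}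

module Defs where

open import Data.Nat using (ℕ; zero; suc; _+_; _∸_; _*_; _≡ᵇ_)
open import Data.Nat.Combinatorics using (_C_)
open import Data.Fin using (Fin; toℕ)
open import Data.Bool using (Bool; true; false; _∧_; _∨_)
open import Data.List using (List; []; _∷_; map; concatMap; allFin; filterᵇ; length; upTo)
open import Data.Bool.ListAction using (and)
open import Data.Nat.ListAction using (sum)
open import Data.Vec using (Vec; []; _∷_; lookup)

-- Hexagons of H_n are indexed by Fin n: hexagon i (1-based in the paper)
-- is index i-1.  Two hexagons are edge-adjacent iff their labels differ by 1 or 2.

dist : ℕ → ℕ → ℕ
dist a b = (a ∸ b) + (b ∸ a)

adjacent : {n : ℕ} → Fin n → Fin n → Bool
adjacent i j = (dist (toℕ i) (toℕ j) ≡ᵇ 1) ∨ (dist (toℕ i) (toℕ j) ≡ᵇ 2)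

-- A tiling of H_n is encoded by its partner map p : hexagon → hexagon
-- (as a vector of length n): p i = i if i is a monomer, and p i = j if
-- {i,j} is a dimer.  Partner maps of tilings are exactly the involutions
-- p with p i = i or p i adjacent to i.
_≡ᶠ_ : {n : ℕ} → Fin n → Fin n → Bool
i ≡ᶠ j = toℕ i ≡ᵇ toℕ j

isTiling : {n : ℕ} → Vec (Fin n) n → Bool
isTiling {n} p =
  and (map (λ i → (lookup p (lookup p i) ≡ᶠ i) ∧ ((lookup p i ≡ᶠ i) ∨ adjacent i (lookup p i)))
      (allFin n))

monomers : {n : ℕ} → Vec (Fin n) n → ℕ
monomers {n} p = length (filterᵇ (λ i → lookup p i ≡ᶠ i) (allFin n))

allVecs : {A : Set} → List A → (m : ℕ) → List (Vec A m)
allVecs xs zero = [] ∷ []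
allVecs xs (suc m) = concatMap (λ x → map (x ∷_) (allVecs xs m)) xs

-- c n k = number of tilings of H_n with exactly k dimers and n - 2k monomers
-- (for 2k ≤ n, having n - 2k monomers is the same as having k dimers)
c : ℕ → ℕ → ℕ
c n k = length (filterᵇ (λ p → isTiling p ∧ (monomers p ≡ᵇ (n ∸ 2 * k))) (allVecs (allFin n) n))

rhs : ℕ → ℕ → ℕ
rhs n k = sum (map (λ m → ((n ∸ k ∸ m) C m) * ((n ∸ k ∸ m) C (n ∸ 2 * k))) (upTo (suc k)))

{-# OPTIONS --safe #-}

-- Read from the left, a tiling of H_n splits uniquely into blocks of four kinds: a monomer, a
-- slanted dimer, a horizontal dimer enclosing a monomer, and two interleaved horizontal dimers.
-- A block either contains a monomer or not, and either contains horizontal dimers or not, and the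
-- four kinds realise exactly these four combinations. Hence the tilings made of N blocks, u of them
-- with a monomer and w of them horizontal, number C(N,u)·C(N,w) (Pascal's rule in both counts,
-- peeling off the first block). Such a tiling covers n = 2(N + w) − u hexagons, so with u = n − 2k
-- monomers N = n − k − w, and u ≤ N forces w ≤ k.

module Submission where

open import Defs
open import Data.Bool using (Bool; true; false; T; _∧_; _∨_)
open import Data.Bool.Properties using (T-∧)
open import Data.Empty using (⊥-elim)
open import Data.Fin using (Fin; zero; suc; toℕ; #_; _↑ˡ_; _↑ʳ_; splitAt)
import Data.Fin.Properties as Fin
open import Data.List
  using (List; []; _∷_; _++_; map; concatMap; cartesianProductWith; length; filterᵇ; tabulate; allFin; upTo)
open import Data.List.Properties using (length-++; length-map; filter-++; map-cong)
open import Data.List.Membership.Propositional using (_∈_; find)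
open import Data.List.Membership.Propositional.Properties
  using (∈-map⁺; ∈-map⁻; ∈-concat⁺′; ∈-concatMap⁻; ∈-filter⁺; ∈-filter⁻; ∈-allFin; ∈-upTo⁺; ∈-upTo⁻)
open import Data.List.Membership.Propositional.Properties.WithK using (unique∧set⇒bag)
open import Data.List.Relation.Binary.BagAndSetEquality using (_∼[_]_; set; ∼bag⇒↭)
open import Data.List.Relation.Binary.Disjoint.Propositional using (Disjoint)
open import Data.List.Relation.Binary.Permutation.Propositional.Properties using (↭-length)
open import Data.List.Relation.Unary.All as All using ([]; _∷_)
import Data.List.Relation.Unary.All.Properties as Allₚ
open import Data.List.Relation.Unary.Any using (here; there)
open import Data.List.Relation.Unary.AllPairs as AllPairs using ([]; _∷_)
import Data.List.Relation.Unary.AllPairs.Properties as AllPairsₚ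
open import Data.List.Relation.Unary.Unique.Propositional using (Unique)
import Data.List.Relation.Unary.Unique.Propositional.Properties as Uniqueₚ
open import Data.Maybe using (Maybe; just; nothing)
open import Data.Maybe.Properties using (just-injective)
open import Data.Nat using (ℕ; zero; suc; _+_; _*_; _∸_; _≤_; z≤n; s≤s; s≤s⁻¹; ⌊_/2⌋; _≡ᵇ_)
open import Data.Nat.Combinatorics using (_C_; nCk+nC[k+1]≡[n+1]C[k+1])
open import Data.Nat.ListAction using (sum)
open import Data.Nat.Properties
  using ( ≡ᵇ⇒≡; ≡⇒≡ᵇ; *-comm; *-zeroʳ; +-identityʳ; +-mono-≤; +-monoˡ-≤; +-cancelˡ-≤; +-cancelˡ-≡; +-cancelʳ-≡
        ; *-cancelˡ-≡; m+n∸n≡m; m∸n+n≡m; ≤-trans; ≤-reflexive; m≤n+m; ⌊n/2⌋≤⌈n/2⌉; ⌊n/2⌋+⌈n/2⌉≡n)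
open import Data.Nat.Tactic.RingSolver using (solve-∀)
open import Data.Product using (Σ; ∃; ∃₂; _×_; _,_; proj₁; proj₂)
open import Data.Product.Properties.WithK using (,-injectiveʳ)
open import Data.Sum using (inj₁; inj₂)
open import Data.Vec as Vec using (Vec; []; _∷_; lookup)
open import Data.Vec.Properties using (lookup-++ˡ; lookup-++ʳ; lookup-map; ++-injectiveʳ; ∷-injective)
open import Function using (_∘_; id; _⇔_; mk⇔; Equivalence)
open import Relation.Binary.PropositionalEquality
  using (_≡_; _≢_; refl; sym; trans; cong; cong₂; subst; module ≡-Reasoning)
open import Relation.Nullary using (contradiction)
open import Relation.Nullary.Decidable using (T?)

open ≡-Reasoning

unique∧set⇒length≡ : {A : Set} {xs ys : List A} → Unique xs → Unique ys → xs ∼[ set ] ys →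
                     length xs ≡ length ys
unique∧set⇒length≡ xs! ys! xs≈ys = ↭-length (∼bag⇒↭ (unique∧set⇒bag xs! ys! xs≈ys))

∈-concatMap⁺′ : {A B : Set} (f : A → List B) {xs : List A} {x : A} {y : B} →
                y ∈ f x → x ∈ xs → y ∈ concatMap f xs
∈-concatMap⁺′ f y∈ x∈ = ∈-concat⁺′ y∈ (∈-map⁺ f x∈)

length-concatMap : {A B : Set} (f : A → List B) (xs : List A) →
                   length (concatMap f xs) ≡ sum (map (length ∘ f) xs)
length-concatMap f []       = refl
length-concatMap f (x ∷ xs) = trans (length-++ (f x)) (cong (length (f x) +_) (length-concatMap f xs))

concatMap≡cartesianProductWith : {A B C : Set} (f : A → B → C) (xs : List A) (ys : List B) →
                                 concatMap (λ x → map (f x) ys) xs ≡ cartesianProductWith f xs ys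
concatMap≡cartesianProductWith f []       ys = refl
concatMap≡cartesianProductWith f (x ∷ xs) ys = cong (map (f x) ys ++_) (concatMap≡cartesianProductWith f xs ys)

tabulate-↑ : {A : Set} (L : ℕ) {m : ℕ} (g : Fin (L + m) → A) →
             tabulate g ≡ tabulate (g ∘ (_↑ˡ m)) ++ tabulate (g ∘ (L ↑ʳ_))
tabulate-↑ zero    g = refl
tabulate-↑ (suc L) g = cong (g zero ∷_) (tabulate-↑ L (g ∘ suc))

length-filterᵇ-tabulate-cong : {A B : Set} {n : ℕ} (f : A → Bool) (g : Fin n → A)
                               (f′ : B → Bool) (g′ : Fin n → B) →
                               (∀ i → f (g i) ≡ f′ (g′ i)) →
                               length (filterᵇ f (tabulate g)) ≡ length (filterᵇ f′ (tabulate g′))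
length-filterᵇ-tabulate-cong {n = zero}  f g f′ g′ eq = refl
length-filterᵇ-tabulate-cong {n = suc n} f g f′ g′ eq with f (g zero) | f′ (g′ zero) | eq zero
... | true  | true  | _ = cong suc (length-filterᵇ-tabulate-cong f (g ∘ suc) f′ (g′ ∘ suc) (eq ∘ suc))
... | false | false | _ = length-filterᵇ-tabulate-cong f (g ∘ suc) f′ (g′ ∘ suc) (eq ∘ suc)

∈-allVecs : {A : Set} {xs : List A} → (∀ x → x ∈ xs) → ∀ {m} (v : Vec A m) → v ∈ allVecs xs m
∈-allVecs all∈ []      = here refl
∈-allVecs all∈ (x ∷ v) = ∈-concatMap⁺′ _ (∈-map⁺ (x ∷_) (∈-allVecs all∈ v)) (all∈ x)

allVecs-unique : {A : Set} {xs : List A} → Unique xs → ∀ m → Unique (allVecs xs m)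
allVecs-unique xs! zero = [] ∷ []
allVecs-unique {xs = xs} xs! (suc m) =
  subst Unique (sym (concatMap≡cartesianProductWith _∷_ xs (allVecs xs m)))
        (Uniqueₚ.cartesianProductWith⁺ _∷_ ∷-injective xs! (allVecs-unique xs! m))

map-injective : {A B : Set} {f : A → B} → (∀ {x y} → f x ≡ f y → x ≡ y) →
                ∀ {k} {xs ys : Vec A k} → Vec.map f xs ≡ Vec.map f ys → xs ≡ ys
map-injective f-inj {xs = []}     {[]}     _  = refl
map-injective f-inj {xs = x ∷ xs} {y ∷ ys} eq =
  cong₂ _∷_ (f-inj (proj₁ (∷-injective eq))) (map-injective f-inj (proj₂ (∷-injective eq)))

map-preimage : {A B : Set} (f : A → B) {k : ℕ} (v : Vec B k) →
               (∀ j → ∃ λ a → lookup v j ≡ f a) → ∃ λ q → v ≡ Vec.map f q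
map-preimage f []      _   = [] , refl
map-preimage f (b ∷ v) hit with hit zero | map-preimage f v (hit ∘ suc)
... | a , refl | q , refl = a ∷ q , refl

↑ˡ≢↑ʳ : {L m : ℕ} (i : Fin L) (j : Fin m) → i ↑ˡ m ≢ L ↑ʳ j
↑ˡ≢↑ʳ zero    j ()
↑ˡ≢↑ʳ (suc i) j eq = ↑ˡ≢↑ʳ i j (Fin.suc-injective eq)

tiles : ℕ → ℕ → ℕ → Bool
tiles i j k = (k ≡ᵇ i) ∧ ((j ≡ᵇ i) ∨ ((dist i j ≡ᵇ 1) ∨ (dist i j ≡ᵇ 2)))

tileAt : {n : ℕ} → Vec (Fin n) n → Fin n → Bool
tileAt p i = tiles (toℕ i) (toℕ (lookup p i)) (toℕ (lookup p (lookup p i)))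

isFixed : {n : ℕ} → Vec (Fin n) n → Fin n → Bool
isFixed p i = lookup p i ≡ᶠ i

record IsTiling {n : ℕ} (p : Vec (Fin n) n) : Set where
  constructor tiled
  field tiledAt : ∀ i → T (tileAt p i)
open IsTiling

isTiling⇔IsTiling : {n : ℕ} {p : Vec (Fin n) n} → T (isTiling p) ⇔ IsTiling p
isTiling⇔IsTiling {n} {p} = mk⇔
  (λ t → tiled λ i → All.lookup (Allₚ.all⁺ (tileAt p) (allFin n) t) (∈-allFin i))
  (λ t → Allₚ.all⁻ (tileAt p) {xs = allFin n} (All.tabulate (λ {i} _ → tiledAt t i)))

IsTiling⇒involutive : {n : ℕ} {p : Vec (Fin n) n} → IsTiling p → ∀ i → lookup p (lookup p i) ≡ i
IsTiling⇒involutive t i = Fin.toℕ-injective (≡ᵇ⇒≡ _ _ (proj₁ (Equivalence.to T-∧ (tiledAt t i))))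

IsTiling⇒fixed-or-adjacent : {n : ℕ} {p : Vec (Fin n) n} → IsTiling p →
                             ∀ i → T ((lookup p i ≡ᶠ i) ∨ adjacent i (lookup p i))
IsTiling⇒fixed-or-adjacent t i = proj₂ (Equivalence.to T-∧ (tiledAt t i))

tiles-+ : ∀ c i j k → tiles (c + i) (c + j) (c + k) ≡ tiles i j k
tiles-+ zero    i j k = refl
tiles-+ (suc c) i j k = tiles-+ c i j k

≡ᵇ-+ : ∀ c i j → (c + i ≡ᵇ c + j) ≡ (i ≡ᵇ j)
≡ᵇ-+ zero    i j = refl
≡ᵇ-+ (suc c) i j = ≡ᵇ-+ c i j

module Embedding {a b : ℕ} (p : Vec (Fin a) a) (P : Vec (Fin b) b) (f : Fin a → Fin b) (c : ℕ)
                 (toℕ-f : ∀ i → toℕ (f i) ≡ c + toℕ i) (lookup-f : ∀ i → lookup P (f i) ≡ f (lookup p i)) where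

  tileAt-embed : ∀ i → tileAt P (f i) ≡ tileAt p i
  tileAt-embed i = begin
    tiles (toℕ (f i)) (toℕ (lookup P (f i))) (toℕ (lookup P (lookup P (f i))))
      ≡⟨ cong₂ (λ x y → tiles (toℕ (f i)) (toℕ x) (toℕ y))
               (lookup-f i) (trans (cong (lookup P) (lookup-f i)) (lookup-f (lookup p i))) ⟩
    tiles (toℕ (f i)) (toℕ (f (lookup p i))) (toℕ (f (lookup p (lookup p i))))
      ≡⟨ shifted (toℕ-f i) (toℕ-f (lookup p i)) (toℕ-f (lookup p (lookup p i))) ⟩
    tileAt p i ∎
    where
    shifted : ∀ {i′ j′ k′ i j k} → i′ ≡ c + i → j′ ≡ c + j → k′ ≡ c + k → tiles i′ j′ k′ ≡ tiles i j k
    shifted refl refl refl = tiles-+ c _ _ _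

  isFixed-embed : ∀ i → isFixed P (f i) ≡ isFixed p i
  isFixed-embed i = begin
    (toℕ (lookup P (f i)) ≡ᵇ toℕ (f i))      ≡⟨ cong (λ x → toℕ x ≡ᵇ toℕ (f i)) (lookup-f i) ⟩
    (toℕ (f (lookup p i)) ≡ᵇ toℕ (f i))      ≡⟨ cong₂ _≡ᵇ_ (toℕ-f (lookup p i)) (toℕ-f i) ⟩
    (c + toℕ (lookup p i) ≡ᵇ c + toℕ i)      ≡⟨ ≡ᵇ-+ c _ _ ⟩
    isFixed p i ∎

infixr 5 _⊕_
_⊕_ : {L m : ℕ} → Vec (Fin L) L → Vec (Fin m) m → Vec (Fin (L + m)) (L + m)
_⊕_ {L} {m} p q = Vec.map (_↑ˡ m) p Vec.++ Vec.map (L ↑ʳ_) q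

module _ {L m : ℕ} (p : Vec (Fin L) L) (q : Vec (Fin m) m) where

  lookup-⊕ˡ : ∀ i → lookup (p ⊕ q) (i ↑ˡ m) ≡ lookup p i ↑ˡ m
  lookup-⊕ˡ i = trans (lookup-++ˡ (Vec.map (_↑ˡ m) p) _ i) (lookup-map i (_↑ˡ m) p)

  lookup-⊕ʳ : ∀ j → lookup (p ⊕ q) (L ↑ʳ j) ≡ L ↑ʳ lookup q j
  lookup-⊕ʳ j = trans (lookup-++ʳ (Vec.map (_↑ˡ m) p) _ j) (lookup-map j (L ↑ʳ_) q)

  private
    module Left  = Embedding p (p ⊕ q) (_↑ˡ m) 0 (λ i → Fin.toℕ-↑ˡ i m) lookup-⊕ˡ
    module Right = Embedding q (p ⊕ q) (L ↑ʳ_) L (Fin.toℕ-↑ʳ L) lookup-⊕ʳ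

  ⊕-isTiling : IsTiling p → IsTiling q → IsTiling (p ⊕ q)
  ⊕-isTiling tp tq = tiled tiledAt-⊕
    where
    tiledAt-⊕ : ∀ x → T (tileAt (p ⊕ q) x)
    tiledAt-⊕ x with splitAt L x | Fin.join-splitAt L m x
    ... | inj₁ i | refl = subst T (sym (Left.tileAt-embed i)) (tiledAt tp i)
    ... | inj₂ j | refl = subst T (sym (Right.tileAt-embed j)) (tiledAt tq j)

  ⊕-isTilingʳ : IsTiling (p ⊕ q) → IsTiling q
  ⊕-isTilingʳ t = tiled λ j → subst T (Right.tileAt-embed j) (tiledAt t (L ↑ʳ j))

  monomers-⊕ : monomers (p ⊕ q) ≡ monomers p + monomers q
  monomers-⊕ = begin
    length (filterᵇ F (tabulate id))
      ≡⟨ cong (length ∘ filterᵇ F) (tabulate-↑ L id) ⟩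
    length (filterᵇ F (tabulate (_↑ˡ m) ++ tabulate (L ↑ʳ_)))
      ≡⟨ cong length (filter-++ (T? ∘ F) (tabulate (_↑ˡ m)) _) ⟩
    length (filterᵇ F (tabulate (_↑ˡ m)) ++ filterᵇ F (tabulate (L ↑ʳ_)))
      ≡⟨ length-++ (filterᵇ F (tabulate (_↑ˡ m))) ⟩
    length (filterᵇ F (tabulate (_↑ˡ m))) + length (filterᵇ F (tabulate (L ↑ʳ_)))
      ≡⟨ cong₂ _+_ (length-filterᵇ-tabulate-cong F (_↑ˡ m) (isFixed p) id Left.isFixed-embed)
                   (length-filterᵇ-tabulate-cong F (L ↑ʳ_) (isFixed q) id Right.isFixed-embed) ⟩
    monomers p + monomers q ∎
    where
    F : Fin (L + m) → Bool
    F = isFixed (p ⊕ q)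

⊕-injectiveʳ : {L m : ℕ} (p : Vec (Fin L) L) {q q′ : Vec (Fin m) m} → p ⊕ q ≡ p ⊕ q′ → q ≡ q′
⊕-injectiveʳ {L} {m} p eq = map-injective (Fin.↑ʳ-injective L _ _) (++-injectiveʳ (Vec.map (_↑ˡ m) p) _ eq)

-- A hexagon after the prefix cannot be paired into it: its partner's partner would be in the prefix.
prefix-closed⇒⊕ : {L m : ℕ} (p : Vec (Fin L) L) (rest : Vec (Fin (L + m)) m) →
                  IsTiling (Vec.map (_↑ˡ m) p Vec.++ rest) → ∃ λ q → rest ≡ Vec.map (L ↑ʳ_) q
prefix-closed⇒⊕ {L} {m} p rest t = map-preimage (L ↑ʳ_) rest outside
  where
  P : Vec (Fin (L + m)) (L + m)
  P = Vec.map (_↑ˡ m) p Vec.++ rest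

  outside : ∀ j → ∃ λ y → lookup rest j ≡ L ↑ʳ y
  outside j with splitAt L (lookup rest j) | Fin.join-splitAt L m (lookup rest j)
  ... | inj₂ y | eq = y , sym eq
  ... | inj₁ i | eq = ⊥-elim (↑ˡ≢↑ʳ (lookup p i) j (begin
    lookup p i ↑ˡ m               ≡⟨ sym (trans (lookup-++ˡ (Vec.map (_↑ˡ m) p) rest i) (lookup-map i (_↑ˡ m) p)) ⟩
    lookup P (i ↑ˡ m)             ≡⟨ cong (lookup P) eq ⟩
    lookup P (lookup rest j)      ≡⟨ cong (lookup P) (sym (lookup-++ʳ (Vec.map (_↑ˡ m) p) rest j)) ⟩
    lookup P (lookup P (L ↑ʳ j))  ≡⟨ IsTiling⇒involutive t (L ↑ʳ j) ⟩
    L ↑ʳ j                        ∎))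

-- The four ways a tiling can start (hexagons numbered from 1): a monomer {1}, a slanted dimer {1,2},
-- a horizontal dimer {1,3} with the monomer {2}, and the two horizontal dimers {1,3}, {2,4}.
data Block : Set where
  monomer slanted horizontal horizontalPair : Block

width : Block → ℕ
width monomer        = 1
width slanted        = 2
width horizontal     = 3
width horizontalPair = 4

blockPartners : (β : Block) → Vec (Fin (width β)) (width β)
blockPartners monomer        = # 0 ∷ []
blockPartners slanted        = # 1 ∷ # 0 ∷ []
blockPartners horizontal     = # 2 ∷ # 1 ∷ # 0 ∷ []
blockPartners horizontalPair = # 2 ∷ # 3 ∷ # 0 ∷ # 1 ∷ []

horizontalBlocks : Block → ℕ
horizontalBlocks monomer        = 0
horizontalBlocks slanted        = 0
horizontalBlocks horizontal     = 1
horizontalBlocks horizontalPair = 1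

blockPartners-isTiling : ∀ β → IsTiling (blockPartners β)
blockPartners-isTiling β = Equivalence.to isTiling⇔IsTiling (checked β)
  where
  checked : ∀ β → T (isTiling (blockPartners β))
  checked monomer        = _
  checked slanted        = _
  checked horizontal     = _
  checked horizontalPair = _

width+monomers : ∀ β → width β + monomers (blockPartners β) ≡ 2 * suc (horizontalBlocks β)
width+monomers monomer        = refl
width+monomers slanted        = refl
width+monomers horizontal     = refl
width+monomers horizontalPair = refl

monomers-block≤1 : ∀ β → monomers (blockPartners β) ≤ 1
monomers-block≤1 monomer        = s≤s z≤n
monomers-block≤1 slanted        = z≤n
monomers-block≤1 horizontal     = s≤s z≤n
monomers-block≤1 horizontalPair = z≤n

-- Partner maps of strips of any length: the enumeration below recurses on the number of blocks,
-- which does not determine the length.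
PartnerMap : Set
PartnerMap = Σ ℕ λ n → Vec (Fin n) n

⟨_⟩ : {n : ℕ} → Vec (Fin n) n → PartnerMap
⟨_⟩ {n} p = n , p

prepend : Block → PartnerMap → PartnerMap
prepend β (m , q) = ⟨ blockPartners β ⊕ q ⟩

leadingBlock : PartnerMap → Maybe Block
leadingBlock (_ , zero ∷ _)                                  = just monomer
leadingBlock (_ , suc zero ∷ _)                              = just slanted
leadingBlock (_ , suc (suc zero) ∷ suc zero ∷ _)             = just horizontal
leadingBlock (_ , suc (suc zero) ∷ suc (suc (suc zero)) ∷ _) = just horizontalPair
leadingBlock _                                               = nothing

leadingBlock-prepend : ∀ β x → leadingBlock (prepend β x) ≡ just β
leadingBlock-prepend monomer        _ = refl
leadingBlock-prepend slanted        _ = refl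
leadingBlock-prepend horizontal     _ = refl
leadingBlock-prepend horizontalPair _ = refl

prepend-injective : ∀ {β β′} x y → prepend β x ≡ prepend β′ y → β ≡ β′ × x ≡ y
prepend-injective {β} {β′} (m , q) (m′ , q′) eq
  with just-injective (trans (sym (leadingBlock-prepend β (m , q)))
                             (trans (cong leadingBlock eq) (leadingBlock-prepend β′ (m′ , q′))))
... | refl with +-cancelˡ-≡ (width β) m m′ (cong proj₁ eq)
... | refl = refl , cong (m ,_) (⊕-injectiveʳ (blockPartners β) (,-injectiveʳ eq))

data Decomposition : {n : ℕ} → Vec (Fin n) n → ℕ → ℕ → ℕ → Set where
  []  : Decomposition [] 0 0 0
  _∷_ : ∀ β {m} {q : Vec (Fin m) m} {N u w} → Decomposition q N u w →
        Decomposition (blockPartners β ⊕ q) (suc N) (monomers (blockPartners β) + u) (horizontalBlocks β + w)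

Decomposition⇒IsTiling : {n N u w : ℕ} {p : Vec (Fin n) n} → Decomposition p N u w → IsTiling p
Decomposition⇒IsTiling []      = tiled λ ()
Decomposition⇒IsTiling (β ∷ d) =
  ⊕-isTiling (blockPartners β) _ (blockPartners-isTiling β) (Decomposition⇒IsTiling d)

Decomposition⇒monomers : {n N u w : ℕ} {p : Vec (Fin n) n} → Decomposition p N u w → monomers p ≡ u
Decomposition⇒monomers []                = refl
Decomposition⇒monomers (_∷_ β {q = q} d) =
  trans (monomers-⊕ (blockPartners β) q) (cong (monomers (blockPartners β) +_) (Decomposition⇒monomers d))

Decomposition⇒u≤N : {n N u w : ℕ} {p : Vec (Fin n) n} → Decomposition p N u w → u ≤ N
Decomposition⇒u≤N []      = z≤n
Decomposition⇒u≤N (β ∷ d) = +-mono-≤ (monomers-block≤1 β) (Decomposition⇒u≤N d)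

Decomposition⇒size : {n N u w : ℕ} {p : Vec (Fin n) n} → Decomposition p N u w → n + u ≡ 2 * (N + w)
Decomposition⇒size []                             = refl
Decomposition⇒size (_∷_ β {m} {_} {N} {u} {w} d) = begin
  (width β + m) + (monomers (blockPartners β) + u)   ≡⟨ interchange (width β) m _ u ⟩
  (width β + monomers (blockPartners β)) + (m + u)   ≡⟨ cong₂ _+_ (width+monomers β) (Decomposition⇒size d) ⟩
  2 * suc (horizontalBlocks β) + 2 * (N + w)         ≡⟨ regroup (horizontalBlocks β) N w ⟩
  2 * (suc N + (horizontalBlocks β + w))             ∎
  where
  interchange : ∀ a b c d → (a + b) + (c + d) ≡ (a + c) + (b + d)
  interchange = solve-∀
  regroup : ∀ h N w → 2 * suc h + 2 * (N + w) ≡ 2 * (suc N + (h + w))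
  regroup = solve-∀

Decomposition-w-unique : ∀ {n n′ N N′ u u′ w w′} {p : Vec (Fin n) n} {p′ : Vec (Fin n′) n′} →
                         Decomposition p N u w → Decomposition p′ N′ u′ w′ → ⟨ p ⟩ ≡ ⟨ p′ ⟩ → w ≡ w′
Decomposition-w-unique []      []       _  = refl
Decomposition-w-unique []      (β ∷ _)  eq =
  contradiction (trans (cong leadingBlock eq) (leadingBlock-prepend β _)) λ ()
Decomposition-w-unique (β ∷ _) []       eq =
  contradiction (trans (cong leadingBlock (sym eq)) (leadingBlock-prepend β _)) λ ()
Decomposition-w-unique (_∷_ β {m} {q} d) (_∷_ β′ {m′} {q′} d′) eq with prepend-injective (m , q) (m′ , q′) eq
... | refl , eq′ = cong (horizontalBlocks β +_) (Decomposition-w-unique d d′ eq′)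

Decomposable : {n : ℕ} → Vec (Fin n) n → Set
Decomposable p = ∃₂ λ N w → Decomposition p N (monomers p) w

Decomposable-⊕ : ∀ β {m} {q : Vec (Fin m) m} → Decomposable q → Decomposable (blockPartners β ⊕ q)
Decomposable-⊕ β {q = q} (N , w , d) =
  suc N , horizontalBlocks β + w ,
  subst (λ u → Decomposition (blockPartners β ⊕ q) (suc N) u (horizontalBlocks β + w))
        (sym (monomers-⊕ (blockPartners β) q)) (β ∷ d)

-- The partners of the first hexagons fix the leading block; every other start violates the
-- tiling condition at hexagon 1 or 2.
decompose : {n : ℕ} (p : Vec (Fin n) n) → IsTiling p → Decomposable p
decompose [] _ = 0 , 0 , []
decompose (zero ∷ rest) t with prefix-closed⇒⊕ (blockPartners monomer) rest t
... | q , refl = Decomposable-⊕ monomer (decompose q (⊕-isTilingʳ (blockPartners monomer) q t))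
decompose (suc zero ∷ zero ∷ rest) t with prefix-closed⇒⊕ (blockPartners slanted) rest t
... | q , refl = Decomposable-⊕ slanted (decompose q (⊕-isTilingʳ (blockPartners slanted) q t))
decompose (suc (suc zero) ∷ suc zero ∷ zero ∷ rest) t with prefix-closed⇒⊕ (blockPartners horizontal) rest t
... | q , refl = Decomposable-⊕ horizontal (decompose q (⊕-isTilingʳ (blockPartners horizontal) q t))
decompose (suc (suc zero) ∷ suc (suc (suc zero)) ∷ zero ∷ suc zero ∷ rest) t
  with prefix-closed⇒⊕ (blockPartners horizontalPair) rest t
... | q , refl = Decomposable-⊕ horizontalPair (decompose q (⊕-isTilingʳ (blockPartners horizontalPair) q t))
decompose (suc zero ∷ suc _ ∷ _)                                          t = ⊥-elim (tiledAt t zero)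
decompose (suc (suc zero) ∷ _ ∷ suc _ ∷ _)                                t = ⊥-elim (tiledAt t zero)
decompose (suc (suc zero) ∷ zero ∷ zero ∷ _)                              t = ⊥-elim (tiledAt t (suc zero))
decompose (suc (suc zero) ∷ suc (suc zero) ∷ zero ∷ _)                    t = ⊥-elim (tiledAt t (suc zero))
decompose (suc (suc zero) ∷ suc (suc (suc zero)) ∷ zero ∷ zero ∷ _)       t = ⊥-elim (tiledAt t (suc zero))
decompose (suc (suc zero) ∷ suc (suc (suc zero)) ∷ zero ∷ suc (suc _) ∷ _) t = ⊥-elim (tiledAt t (suc zero))
decompose (suc (suc zero) ∷ suc (suc (suc (suc _))) ∷ zero ∷ _)            t =
  ⊥-elim (IsTiling⇒fixed-or-adjacent t (suc zero))
decompose (suc (suc (suc _)) ∷ _)                                          t =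
  ⊥-elim (IsTiling⇒fixed-or-adjacent t zero)

-- N C (u − d), taken to be 0 (not the truncated N C 0) when u < d.
_C[_-_] : ℕ → ℕ → ℕ → ℕ
N C[ u     - zero  ] = N C u
N C[ zero  - suc d ] = 0
N C[ suc u - suc d ] = N C[ u - d ]

pascal : ∀ N u → suc N C u ≡ N C[ u - 1 ] + N C u
pascal N zero    = refl
pascal N (suc u) = sym (nCk+nC[k+1]≡[n+1]C[k+1] N u)

tailsAfter : {A : Set} → Block → (ℕ → ℕ → List A) → ℕ → ℕ → List A
tailsAfter monomer        f (suc u) w       = f u w
tailsAfter slanted        f u       w       = f u w
tailsAfter horizontal     f (suc u) (suc w) = f u w
tailsAfter horizontalPair f u       (suc w) = f u w
tailsAfter _              _ _       _       = []

module _ {A : Set} where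

  ∈-tailsAfter⁻ : ∀ β {f : ℕ → ℕ → List A} {u w x} (P : ℕ → ℕ → Set) →
                  (∀ {u w} → x ∈ f u w → P (monomers (blockPartners β) + u) (horizontalBlocks β + w)) →
                  x ∈ tailsAfter β f u w → P u w
  ∈-tailsAfter⁻ monomer        {u = suc u}           P h x∈ = h x∈
  ∈-tailsAfter⁻ slanted                              P h x∈ = h x∈
  ∈-tailsAfter⁻ horizontal     {u = suc u} {suc w}   P h x∈ = h x∈
  ∈-tailsAfter⁻ horizontalPair {w = suc w}           P h x∈ = h x∈
  ∈-tailsAfter⁻ monomer        {u = zero}            P h ()
  ∈-tailsAfter⁻ horizontal     {u = zero}            P h ()
  ∈-tailsAfter⁻ horizontal     {u = suc u} {zero}    P h ()
  ∈-tailsAfter⁻ horizontalPair {w = zero}            P h ()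

  ∈-tailsAfter⁺ : ∀ β {f : ℕ → ℕ → List A} {u w x} → x ∈ f u w →
                  x ∈ tailsAfter β f (monomers (blockPartners β) + u) (horizontalBlocks β + w)
  ∈-tailsAfter⁺ monomer        x∈ = x∈
  ∈-tailsAfter⁺ slanted        x∈ = x∈
  ∈-tailsAfter⁺ horizontal     x∈ = x∈
  ∈-tailsAfter⁺ horizontalPair x∈ = x∈

  tailsAfter-unique : ∀ β {f : ℕ → ℕ → List A} → (∀ u w → Unique (f u w)) → ∀ u w → Unique (tailsAfter β f u w)
  tailsAfter-unique monomer        f! (suc u) w       = f! u w
  tailsAfter-unique slanted        f! u       w       = f! u w
  tailsAfter-unique horizontal     f! (suc u) (suc w) = f! u w
  tailsAfter-unique horizontalPair f! u       (suc w) = f! u w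
  tailsAfter-unique monomer        f! zero    w       = []
  tailsAfter-unique horizontal     f! zero    w       = []
  tailsAfter-unique horizontal     f! (suc u) zero    = []
  tailsAfter-unique horizontalPair f! u       zero    = []

  length-tailsAfter : ∀ β {f : ℕ → ℕ → List A} N → (∀ u w → length (f u w) ≡ (N C u) * (N C w)) →
                      ∀ u w → length (tailsAfter β f u w) ≡
                              N C[ u - monomers (blockPartners β) ] * N C[ w - horizontalBlocks β ]
  length-tailsAfter monomer        N len (suc u) w       = len u w
  length-tailsAfter slanted        N len u       w       = len u w
  length-tailsAfter horizontal     N len (suc u) (suc w) = len u w
  length-tailsAfter horizontalPair N len u       (suc w) = len u w
  length-tailsAfter monomer        N len zero    w       = refl
  length-tailsAfter horizontal     N len zero    w       = refl
  length-tailsAfter horizontal     N len (suc u) zero    = sym (*-zeroʳ (N C u))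
  length-tailsAfter horizontalPair N len u       zero    = sym (*-zeroʳ (N C u))

allBlocks : List Block
allBlocks = monomer ∷ slanted ∷ horizontal ∷ horizontalPair ∷ []

∈-allBlocks : ∀ β → β ∈ allBlocks
∈-allBlocks monomer        = here refl
∈-allBlocks slanted        = there (here refl)
∈-allBlocks horizontal     = there (there (here refl))
∈-allBlocks horizontalPair = there (there (there (here refl)))

allBlocks-unique : Unique allBlocks
allBlocks-unique = ((λ ()) ∷ (λ ()) ∷ (λ ()) ∷ []) ∷ ((λ ()) ∷ (λ ()) ∷ []) ∷ ((λ ()) ∷ []) ∷ [] ∷ []

map-prepend-disjoint : ∀ {β β′} → β ≢ β′ → (xs ys : List PartnerMap) →
                       Disjoint (map (prepend β) xs) (map (prepend β′) ys)
map-prepend-disjoint β≢β′ xs ys (x∈ , x∈′) with ∈-map⁻ (prepend _) x∈ | ∈-map⁻ (prepend _) x∈′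
... | y , _ , refl | y′ , _ , eq = β≢β′ (proj₁ (prepend-injective y y′ eq))

startingWith : (ℕ → ℕ → List PartnerMap) → ℕ → ℕ → Block → List PartnerMap
startingWith f u w β = map (prepend β) (tailsAfter β f u w)

blockTilings : (N u w : ℕ) → List PartnerMap
blockTilings zero    zero zero = ⟨ [] ⟩ ∷ []
blockTilings zero    _    _    = []
blockTilings (suc N) u    w    = concatMap (startingWith (blockTilings N) u w) allBlocks

∈-blockTilings⁻ : ∀ N {u w n} {p : Vec (Fin n) n} → ⟨ p ⟩ ∈ blockTilings N u w → Decomposition p N u w
∈-blockTilings⁻ zero    {zero}  {zero}  (here refl) = []
∈-blockTilings⁻ zero    {zero}  {zero}  (there ())
∈-blockTilings⁻ zero    {zero}  {suc w} ()
∈-blockTilings⁻ zero    {suc u}         ()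
∈-blockTilings⁻ (suc N) {u}     {w}     p∈
  with find (∈-concatMap⁻ (startingWith (blockTilings N) u w) {xs = allBlocks} p∈)
... | β , _ , p∈β with ∈-map⁻ (prepend β) p∈β
... | (m , q) , q∈ , refl =
  ∈-tailsAfter⁻ β (Decomposition (blockPartners β ⊕ q) (suc N)) (λ q∈′ → β ∷ ∈-blockTilings⁻ N q∈′) q∈

∈-blockTilings⁺ : ∀ {n N u w} {p : Vec (Fin n) n} → Decomposition p N u w → ⟨ p ⟩ ∈ blockTilings N u w
∈-blockTilings⁺ []      = here refl
∈-blockTilings⁺ (_∷_ β {N = N} d) =
  ∈-concatMap⁺′ (startingWith (blockTilings N) _ _) (∈-map⁺ (prepend β) (∈-tailsAfter⁺ β (∈-blockTilings⁺ d)))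
                (∈-allBlocks β)

blockTilings-unique : ∀ N u w → Unique (blockTilings N u w)
blockTilings-unique zero    zero    zero    = [] ∷ []
blockTilings-unique zero    zero    (suc w) = []
blockTilings-unique zero    (suc u) w       = []
blockTilings-unique (suc N) u       w       =
  Uniqueₚ.concat⁺ (Allₚ.map⁺ {f = part} (All.universal part-unique allBlocks))
                  (AllPairsₚ.map⁺ {f = part} (AllPairs.map part-disjoint allBlocks-unique))
  where
  part : Block → List PartnerMap
  part = startingWith (blockTilings N) u w

  part-unique : ∀ β → Unique (part β)
  part-unique β =
    Uniqueₚ.map⁺ (λ eq → proj₂ (prepend-injective _ _ eq)) (tailsAfter-unique β (blockTilings-unique N) u w)

  part-disjoint : ∀ {β β′} → β ≢ β′ → Disjoint (part β) (part β′)
  part-disjoint β≢β′ = map-prepend-disjoint β≢β′ _ _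

blockTilings-disjoint : ∀ {N N′ u u′ w w′} → w ≢ w′ → Disjoint (blockTilings N u w) (blockTilings N′ u′ w′)
blockTilings-disjoint {N} {N′} w≢w′ {_ , p} (p∈ , p∈′) =
  w≢w′ (Decomposition-w-unique (∈-blockTilings⁻ N p∈) (∈-blockTilings⁻ N′ p∈′) refl)

length-blockTilings : ∀ N u w → length (blockTilings N u w) ≡ (N C u) * (N C w)
length-blockTilings zero    zero    zero    = refl
length-blockTilings zero    zero    (suc w) = refl
length-blockTilings zero    (suc u) w       = refl
length-blockTilings (suc N) u       w       = begin
  length (blockTilings (suc N) u w)
    ≡⟨ length-concatMap (startingWith (blockTilings N) u w) allBlocks ⟩
  sum (map (length ∘ startingWith (blockTilings N) u w) allBlocks)
    ≡⟨ cong sum (map-cong (λ β → trans (length-map (prepend β) (tailsAfter β (blockTilings N) u w))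
                                       (length-tailsAfter β N (length-blockTilings N) u w)) allBlocks) ⟩
  sum (map (λ β → N C[ u - monomers (blockPartners β) ] * N C[ w - horizontalBlocks β ]) allBlocks)
    ≡⟨ factorise (N C[ u - 1 ]) (N C u) (N C[ w - 1 ]) (N C w) ⟩
  (N C[ u - 1 ] + N C u) * (N C[ w - 1 ] + N C w)
    ≡⟨ sym (cong₂ _*_ (pascal N u) (pascal N w)) ⟩
  (suc N C u) * (suc N C w) ∎
  where
  factorise : ∀ a b c d → a * d + (b * d + (a * c + (b * c + 0))) ≡ (a + b) * (c + d)
  factorise = solve-∀

tilingsWith : (n u : ℕ) → List (Vec (Fin n) n)
tilingsWith n u = filterᵇ (λ p → isTiling p ∧ (monomers p ≡ᵇ u)) (allVecs (allFin n) n)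

module _ {n u : ℕ} where

  ∈-tilingsWith⁺ : {p : Vec (Fin n) n} → IsTiling p → monomers p ≡ u → p ∈ tilingsWith n u
  ∈-tilingsWith⁺ {p} t refl =
    ∈-filter⁺ (T? ∘ _) (∈-allVecs ∈-allFin p)
              (Equivalence.from T-∧ (Equivalence.from isTiling⇔IsTiling t , ≡⇒≡ᵇ (monomers p) _ refl))

  ∈-tilingsWith⁻ : {p : Vec (Fin n) n} → p ∈ tilingsWith n u → IsTiling p × monomers p ≡ u
  ∈-tilingsWith⁻ {p} p∈ with Equivalence.to T-∧ (proj₂ (∈-filter⁻ (T? ∘ _) {xs = allVecs (allFin n) n} p∈))
  ... | isT , monomers≡ = Equivalence.to isTiling⇔IsTiling isT , ≡ᵇ⇒≡ _ _ monomers≡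

  tilingsWith-unique : Unique (tilingsWith n u)
  tilingsWith-unique = Uniqueₚ.filter⁺ (T? ∘ _) (allVecs-unique (Uniqueₚ.allFin⁺ n) n)

-- With u monomers and k dimers there are N = u + k − w blocks, w of them horizontal.
blockTilingsWith : ℕ → ℕ → ℕ → List PartnerMap
blockTilingsWith u k w = blockTilings (u + k ∸ w) u w

allBlockTilingsWith : ℕ → ℕ → List PartnerMap
allBlockTilingsWith u k = concatMap (blockTilingsWith u k) (upTo (suc k))

allBlockTilingsWith-unique : ∀ u k → Unique (allBlockTilingsWith u k)
allBlockTilingsWith-unique u k =
  Uniqueₚ.concat⁺ (Allₚ.map⁺ {f = blockTilingsWith u k} (All.universal unique (upTo (suc k))))
                  (AllPairsₚ.map⁺ {f = blockTilingsWith u k} (AllPairs.map disjoint (Uniqueₚ.upTo⁺ (suc k))))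
  where
  unique : ∀ w → Unique (blockTilingsWith u k w)
  unique w = blockTilings-unique (u + k ∸ w) u w

  disjoint : ∀ {w w′} → w ≢ w′ → Disjoint (blockTilingsWith u k w) (blockTilingsWith u k w′)
  disjoint {w} {w′} = blockTilings-disjoint {u + k ∸ w} {u + k ∸ w′} {u} {u}

same-size⇔ : ∀ {n u k n′ N w} → u + 2 * k ≡ n → n′ + u ≡ 2 * (N + w) → (n′ ≡ n) ⇔ (N + w ≡ u + k)
same-size⇔ {n} {u} {k} {n′} {N} {w} u+2k≡n size = mk⇔
  (λ { refl → *-cancelˡ-≡ (N + w) (u + k) 2 (trans (sym size) (trans (cong (_+ u) (sym u+2k≡n)) (double u k))) })
  (λ N+w≡u+k → +-cancelʳ-≡ u n′ n
                  (trans size (trans (cong (2 *_) N+w≡u+k) (trans (sym (double u k)) (cong (_+ u) u+2k≡n)))))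
  where
  double : ∀ u k → u + 2 * k + u ≡ 2 * (u + k)
  double = solve-∀

tilingsWith⊆allBlockTilingsWith : ∀ {n u k} → u + 2 * k ≡ n →
                                  ∀ {x} → x ∈ map ⟨_⟩ (tilingsWith n u) → x ∈ allBlockTilingsWith u k
tilingsWith⊆allBlockTilingsWith {u = u} {k} u+2k≡n x∈ with ∈-map⁻ ⟨_⟩ x∈
... | p , p∈ , refl with ∈-tilingsWith⁻ p∈
... | t , monomers≡u with decompose p t
... | N , w , d = ∈-concatMap⁺′ (blockTilingsWith u k)
                                (subst (λ N → ⟨ p ⟩ ∈ blockTilings N u w) N≡u+k∸w (∈-blockTilings⁺ d′))
                                (∈-upTo⁺ (s≤s w≤k))
  where
  d′ : Decomposition p N u w
  d′ = subst (λ u → Decomposition p N u w) monomers≡u d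
  N+w≡u+k : N + w ≡ u + k
  N+w≡u+k = Equivalence.to (same-size⇔ {N = N} {w} u+2k≡n (Decomposition⇒size d′)) refl
  w≤k : w ≤ k
  w≤k = +-cancelˡ-≤ u w k (≤-trans (+-monoˡ-≤ w (Decomposition⇒u≤N d′)) (≤-reflexive N+w≡u+k))
  N≡u+k∸w : N ≡ u + k ∸ w
  N≡u+k∸w = sym (trans (cong (_∸ w) (sym N+w≡u+k)) (m+n∸n≡m N w))

allBlockTilingsWith⊆tilingsWith : ∀ {n u k} → u + 2 * k ≡ n →
                                  ∀ {x} → x ∈ allBlockTilingsWith u k → x ∈ map ⟨_⟩ (tilingsWith n u)
allBlockTilingsWith⊆tilingsWith {n} {u} {k} u+2k≡n {n′ , p} x∈
  with find (∈-concatMap⁻ (blockTilingsWith u k) {xs = upTo (suc k)} x∈)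
... | w , w∈ , p∈ with ∈-blockTilings⁻ (u + k ∸ w) p∈
... | d with Equivalence.from (same-size⇔ {n′ = n′} {u + k ∸ w} {w} u+2k≡n (Decomposition⇒size d))
                              (m∸n+n≡m (≤-trans (s≤s⁻¹ (∈-upTo⁻ w∈)) (m≤n+m k u)))
... | refl = ∈-map⁺ ⟨_⟩ (∈-tilingsWith⁺ (Decomposition⇒IsTiling d) (Decomposition⇒monomers d))

length-tilingsWith : ∀ {n u k} → u + 2 * k ≡ n → length (tilingsWith n u) ≡ length (allBlockTilingsWith u k)
length-tilingsWith {n} {u} {k} u+2k≡n = begin
  length (tilingsWith n u)            ≡⟨ sym (length-map ⟨_⟩ (tilingsWith n u)) ⟩
  length (map ⟨_⟩ (tilingsWith n u))  ≡⟨ unique∧set⇒length≡ (Uniqueₚ.map⁺ ,-injectiveʳ tilingsWith-unique)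
                                                            (allBlockTilingsWith-unique u k)
                                                            (mk⇔ (tilingsWith⊆allBlockTilingsWith u+2k≡n)
                                                                 (allBlockTilingsWith⊆tilingsWith u+2k≡n)) ⟩
  length (allBlockTilingsWith u k)    ∎

theorem2 : (n k : ℕ) → k ≤ ⌊ n /2⌋ → c n k ≡ rhs n k
theorem2 n k k≤⌊n/2⌋ = begin
  c n k                                                ≡⟨ length-tilingsWith u+2k≡n ⟩
  length (allBlockTilingsWith u k)                     ≡⟨ length-concatMap (blockTilingsWith u k) (upTo (suc k)) ⟩
  sum (map (length ∘ blockTilingsWith u k) (upTo (suc k))) ≡⟨ cong sum (map-cong term (upTo (suc k))) ⟩
  rhs n k                                              ∎
  where
  u : ℕ
  u = n ∸ 2 * k

  2k≤n : 2 * k ≤ n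
  2k≤n = ≤-trans (+-mono-≤ k≤⌊n/2⌋ (+-mono-≤ (≤-trans k≤⌊n/2⌋ (⌊n/2⌋≤⌈n/2⌉ n)) z≤n))
                 (≤-reflexive (trans (cong (⌊ n /2⌋ +_) (+-identityʳ _)) (⌊n/2⌋+⌈n/2⌉≡n n)))

  u+2k≡n : u + 2 * k ≡ n
  u+2k≡n = m∸n+n≡m 2k≤n

  n∸k≡u+k : n ∸ k ≡ u + k
  n∸k≡u+k = trans (cong (_∸ k) (trans (sym u+2k≡n) (shuffle u k))) (m+n∸n≡m (u + k) k)
    where
    shuffle : ∀ u k → u + 2 * k ≡ u + k + k
    shuffle = solve-∀

  term : ∀ w → length (blockTilingsWith u k w) ≡ ((n ∸ k ∸ w) C w) * ((n ∸ k ∸ w) C u)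
  term w = begin
    length (blockTilingsWith u k w)          ≡⟨ length-blockTilings _ u w ⟩
    ((u + k ∸ w) C u) * ((u + k ∸ w) C w)    ≡⟨ *-comm ((u + k ∸ w) C u) _ ⟩
    ((u + k ∸ w) C w) * ((u + k ∸ w) C u)    ≡⟨ cong (λ s → ((s ∸ w) C w) * ((s ∸ w) C u)) (sym n∸k≡u+k) ⟩
    ((n ∸ k ∸ w) C w) * ((n ∸ k ∸ w) C u)    ∎
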